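{- Let $M$ be a primitive non-deficient number with at least four distinct prime factors. Suppose that $3\mid M$, $5^2\mid M$ and $11\mid M$. Then either $3\,\|\,M$ or $3^2\,\|\,M$.
   Context: $\sigma(n)$ is the sum of the positive divisors of $n$. A positive integer $n$ is deficient if $\sigma(n)<2n$. A positive integer $M$ is a primitive non-deficient number if $M$ is not deficient but every proper divisor of $M$ is deficient. For a prime power $p^a$, $p^a\,\|\,M$ means $p^a\mid M$ but $p^{a+1}\nmid M$. -}

module Defs where

open import Data.Nat using (ℕ; suc; _+_; _*_; _^_; _<_; _≤_; _≥_)
open import Data.Nat.Divisibility using (_∣_; _∣?_)
open import Data.List using (List; upTo; map; filter)
open import Data.Nat.ListAction using (sum)
open import Relation.Nullary using (¬_)
open import Data.Product using (_×_)

divisors : ℕ → List ℕ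
divisors n = filter (_∣? n) (map suc (upTo n))

σ : ℕ → ℕ
σ n = sum (divisors n)

Deficient : ℕ → Set
Deficient n = σ n < 2 * n

ProperDivisor : ℕ → ℕ → Set
ProperDivisor d M = d ∣ M × d < M × 1 ≤ d

PrimitiveNonDeficient : ℕ → Set
PrimitiveNonDeficient M =
  1 ≤ M × ¬ Deficient M × (∀ d → ProperDivisor d M → Deficient d)

_^_∥_ : ℕ → ℕ → ℕ → Set
p ^ a ∥ M = (p ^ a) ∣ M × ¬ ((p ^ suc a) ∣ M)

{-# OPTIONS --safe #-}
module Submission where

-- If 3³ ∣ M then 3³ · 5² · 11 = 7425 ∣ M. But σ(7425) = 14880 ≥ 2 · 7425, so 7425
-- is not deficient and hence cannot be a proper divisor of the primitive
-- non-deficient M; thus M = 7425, which has only the three prime factors 3, 5, 11.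

open import Defs
open import Data.Nat using (ℕ; zero; suc; _^_; _*_; _<_; _≤_; _≟_; _<?_; s≤s; z≤n; >-nonZero)
open import Data.Nat.Properties using (≤-refl; ≤∧≢⇒<)
open import Data.Nat.Divisibility using (_∣_; ∣⇒≤; _∣?_; ∣1⇒≡1)
open import Data.Nat.LCM using (lcm-least)
open import Data.Nat.Primality using (Prime; euclidsLemma; prime⇒irreducible; prime⇒nonTrivial; prime?)
open import Data.Fin using (Fin; zero; suc) renaming (_<_ to _<ᶠ_)
open import Data.Fin.Properties using (pigeonhole)
open import Data.List using (List; []; _∷_; length; lookup)
open import Data.List.Membership.Propositional using (_∈_)
open import Data.List.Relation.Unary.Any using (here; there; index)
open import Data.List.Relation.Unary.Any.Properties using (lookup-index)
open import Data.Product using (_×_; _,_; ∃₂)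
open import Data.Sum using (_⊎_; inj₁; inj₂)
open import Data.Empty using (⊥-elim)
open import Relation.Nullary using (¬_; yes; no)
open import Relation.Nullary.Decidable using (from-yes; from-no)
open import Relation.Binary.PropositionalEquality using (_≡_; _≢_; refl; sym; trans; cong; subst)

pigeonhole-∈ : ∀ {a} {A : Set a} {xs : List A} {n} → length xs < n →
               (f : Fin n → A) → (∀ i → f i ∈ xs) →
               ∃₂ λ i j → i <ᶠ j × f i ≡ f j
pigeonhole-∈ {xs = xs} len<n f f∈xs with pigeonhole len<n (λ i → index (f∈xs i))
... | i , j , i<j , same-index =
  i , j , i<j , trans (lookup-index (f∈xs i))
                  (trans (cong (lookup xs) same-index) (sym (lookup-index (f∈xs j))))

lookup-pairwise-≢ : ∀ {a} {A : Set a} {x₁ x₂ x₃ x₄ : A} →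
                    x₁ ≢ x₂ × x₁ ≢ x₃ × x₁ ≢ x₄ × x₂ ≢ x₃ × x₂ ≢ x₄ × x₃ ≢ x₄ →
                    ∀ {i j} → i <ᶠ j →
                    lookup (x₁ ∷ x₂ ∷ x₃ ∷ x₄ ∷ []) i ≢ lookup (x₁ ∷ x₂ ∷ x₃ ∷ x₄ ∷ []) j
lookup-pairwise-≢ (≢₁₂ , _) {zero} {suc zero} _ = ≢₁₂
lookup-pairwise-≢ (_ , ≢₁₃ , _) {zero} {suc (suc zero)} _ = ≢₁₃
lookup-pairwise-≢ (_ , _ , ≢₁₄ , _) {zero} {suc (suc (suc zero))} _ = ≢₁₄
lookup-pairwise-≢ (_ , _ , _ , ≢₂₃ , _) {suc zero} {suc (suc zero)} _ = ≢₂₃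
lookup-pairwise-≢ (_ , _ , _ , _ , ≢₂₄ , _) {suc zero} {suc (suc (suc zero))} _ = ≢₂₄
lookup-pairwise-≢ (_ , _ , _ , _ , _ , ≢₃₄) {suc (suc zero)} {suc (suc (suc zero))} _ = ≢₃₄
lookup-pairwise-≢ _ {_} {zero} ()
lookup-pairwise-≢ _ {suc _} {suc zero} (s≤s ())
lookup-pairwise-≢ _ {suc (suc _)} {suc (suc zero)} (s≤s (s≤s ()))
lookup-pairwise-≢ _ {suc (suc (suc _))} {suc (suc (suc zero))} (s≤s (s≤s (s≤s ())))

pigeonhole-∈₄ : ∀ {a} {A : Set a} {xs : List A} {x₁ x₂ x₃ x₄ : A} → length xs < 4 →
                x₁ ∈ xs → x₂ ∈ xs → x₃ ∈ xs → x₄ ∈ xs →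
                ¬ (x₁ ≢ x₂ × x₁ ≢ x₃ × x₁ ≢ x₄ × x₂ ≢ x₃ × x₂ ≢ x₄ × x₃ ≢ x₄)
pigeonhole-∈₄ len<4 ∈₁ ∈₂ ∈₃ ∈₄ distinct
  with i , j , i<j , xᵢ≡xⱼ ← pigeonhole-∈ len<4 _ (λ { zero → ∈₁ ; (suc zero) → ∈₂
                                                     ; (suc (suc zero)) → ∈₃ ; (suc (suc (suc zero))) → ∈₄ })
  = lookup-pairwise-≢ distinct i<j xᵢ≡xⱼ

prime∣prime⇒≡ : ∀ {p q} → Prime p → Prime q → p ∣ q → p ≡ q
prime∣prime⇒≡ p-prime q-prime p∣q with prime⇒irreducible q-prime p∣q
... | inj₂ p≡q = p≡q
... | inj₁ refl with () ← prime⇒nonTrivial p-prime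

prime∣^⇒∣ : ∀ {p} m k → Prime p → p ∣ m ^ k → p ∣ m
prime∣^⇒∣ m zero p-prime p∣1 with refl ← ∣1⇒≡1 p∣1 | () ← prime⇒nonTrivial p-prime
prime∣^⇒∣ m (suc k) p-prime p∣m*mᵏ with euclidsLemma m (m ^ k) p-prime p∣m*mᵏ
... | inj₁ p∣m = p∣m
... | inj₂ p∣mᵏ = prime∣^⇒∣ m k p-prime p∣mᵏ

prime-divisors-7425 : ∀ {p} → Prime p → p ∣ 7425 → p ∈ 3 ∷ 5 ∷ 11 ∷ []
prime-divisors-7425 p-prime p∣7425 with euclidsLemma (3 ^ 3 * 5 ^ 2) 11 p-prime p∣7425
... | inj₂ p∣11 = there (there (here (prime∣prime⇒≡ p-prime (from-yes (prime? 11)) p∣11)))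
... | inj₁ p∣675 with euclidsLemma (3 ^ 3) (5 ^ 2) p-prime p∣675
...   | inj₁ p∣27 = here (prime∣prime⇒≡ p-prime (from-yes (prime? 3)) (prime∣^⇒∣ 3 3 p-prime p∣27))
...   | inj₂ p∣25 = there (here (prime∣prime⇒≡ p-prime (from-yes (prime? 5)) (prime∣^⇒∣ 5 2 p-prime p∣25)))

nonDeficient∣primitiveNonDeficient⇒≡ : ∀ {M d} → PrimitiveNonDeficient M →
                                       d ∣ M → 1 ≤ d → ¬ Deficient d → d ≡ M
nonDeficient∣primitiveNonDeficient⇒≡ {M} {d} (1≤M , _ , proper⇒deficient) d∣M 1≤d ¬def
  with d ≟ M
... | yes d≡M = d≡M
... | no d≢M = ⊥-elim (¬def (proper⇒deficient d (d∣M , ≤∧≢⇒< (∣⇒≤ d∣M) d≢M , 1≤d)))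
  where instance _ = >-nonZero 1≤M

σ[7425]≡14880 : σ 7425 ≡ 14880
σ[7425]≡14880 = refl

¬deficient[7425] : ¬ Deficient 7425
¬deficient[7425] rewrite σ[7425]≡14880 = from-no (14880 <? 14850)

lemma9 : (M : ℕ) → PrimitiveNonDeficient M
    → (p₁ p₂ p₃ p₄ : ℕ)
    → Prime p₁ × Prime p₂ × Prime p₃ × Prime p₄
    → p₁ ∣ M × p₂ ∣ M × p₃ ∣ M × p₄ ∣ M
    → p₁ ≢ p₂ × p₁ ≢ p₃ × p₁ ≢ p₄ × p₂ ≢ p₃ × p₂ ≢ p₄ × p₃ ≢ p₄
    → 3 ∣ M → 5 ^ 2 ∣ M → 11 ∣ M
    → (3 ^ 1 ∥ M) ⊎ (3 ^ 2 ∥ M)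
lemma9 M M-primitive p₁ p₂ p₃ p₄ (P₁ , P₂ , P₃ , P₄) (p₁∣M , p₂∣M , p₃∣M , p₄∣M) distinct 3∣M 25∣M 11∣M
  with 3 ^ 2 ∣? M | 3 ^ 3 ∣? M
... | no 9∤M | _ = inj₁ (3∣M , 9∤M)
... | yes 9∣M | no 27∤M = inj₂ (9∣M , 27∤M)
... | yes _ | yes 27∣M =
  ⊥-elim (pigeonhole-∈₄ ≤-refl
            (divisor-of-7425 P₁ p₁∣M) (divisor-of-7425 P₂ p₂∣M)
            (divisor-of-7425 P₃ p₃∣M) (divisor-of-7425 P₄ p₄∣M) distinct)
  where
  -- the lcm of the pairwise coprime 27, 25, 11 evaluates to their product 7425
  7425∣M : 7425 ∣ M
  7425∣M = lcm-least (lcm-least 27∣M 25∣M) 11∣M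

  M≡7425 : M ≡ 7425
  M≡7425 = sym (nonDeficient∣primitiveNonDeficient⇒≡ M-primitive 7425∣M (s≤s z≤n) ¬deficient[7425])

  divisor-of-7425 : ∀ {p} → Prime p → p ∣ M → p ∈ 3 ∷ 5 ∷ 11 ∷ []
  divisor-of-7425 p-prime p∣M = prime-divisors-7425 p-prime (subst (_ ∣_) M≡7425 p∣M)
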